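{- Let $C\subseteq\mathbb{Z}_2^n$ be a $13$-cap of dimension $7$ with basis $B$, and write $D=C\setminus B=\{x_1,\dots,x_5\}$ and $B_{ij}=B_{x_i}\cap B_{x_j}$. Then $B$ has type $5\text{ - }5\text{ - }5\text{ - }5\text{ - }5$, and there are two disjoint pairs $\{i,j\},\{k,\ell\}\subseteq\{1,\dots,5\}$ with $|B_{ij}|=|B_{k\ell}|=2$, while $|B_{st}|=3$ for all other pairs $\{s,t\}$.
   Context: Work in $\mathbb{Z}_2^n$. An affine combination of a set is a sum of an odd number of its distinct elements; $\operatorname{aff}(S)$ is the set of all affine combinations of elements of $S$, and the dimension of $S$ is the dimension of the affine flat $\operatorname{aff}(S)$. A basis for $S$ is a subset $B\subseteq S$ that is affinely independent (no element is an affine combination of the others) with $\operatorname{aff}(B)=\operatorname{aff}(S)$; its dependent set is $D=S\setminus B$. For $x\in D$, $B_x$ is the unique subset of $B$ whose elements sum to $x$. A quad is a set of four distinct elements summing to $\mathbf{0}$; a cap is a quad-free subset; a $k$-cap is a cap with $k$ elements. The type of $B$ is the list of the numbers $|B_x|$, $x\in D$, in nonincreasing order, separated by hyphens. -}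

module Defs where

open import Data.Bool using (Bool; true; false; if_then_else_; _xor_)
open import Data.Nat using (ℕ; zero; suc; _%_)
open import Data.Fin using (Fin; zero; suc)
open import Data.Fin.Subset using (Subset; _∈_; _∉_; _⊆_; ∁; _∩_; _-_; ∣_∣; ⊤)
open import Data.Vec using (Vec; []; _∷_; zipWith; replicate)
open import Data.Sum using (_⊎_)
open import Data.Product using (Σ; _×_; _,_; ∃)
open import Relation.Binary.PropositionalEquality using (_≡_; _≢_)
open import Relation.Nullary using (¬_)
open import Function using (_∘_)
open import Function.Definitions using (Injective)

V : ℕ → Set
V n = Vec Bool n

infixl 6 _⊕_
_⊕_ : ∀ {n} → V n → V n → V n
_⊕_ = zipWith _xor_

𝟎 : ∀ n → V n
𝟎 n = replicate n false

-- A finite family of points is an indexing  f : Fin m → V n ; a subset of the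
-- family is a  Subset m  (characteristic vector).  Sum of the points of T:
sumOver : ∀ {m n} → (Fin m → V n) → Subset m → V n
sumOver {zero}  {n} f []      = 𝟎 n
sumOver {suc m} {n} f (b ∷ T) = (if b then f zero else 𝟎 n) ⊕ sumOver (f ∘ suc) T

Odd : ℕ → Set
Odd k = k % 2 ≡ 1

-- x is an affine combination of the points of S (sum of an odd number of
-- distinct elements of S).
InAff : ∀ {m n} → (Fin m → V n) → Subset m → V n → Set
InAff f S x = Σ (Subset _) λ T → T ⊆ S × Odd ∣ T ∣ × sumOver f T ≡ x

SameAff : ∀ {m m' n} → (Fin m → V n) → Subset m → (Fin m' → V n) → Subset m' → Set
SameAff {n = n} f S g S' = (x : V n) → (InAff f S x → InAff g S' x) × (InAff g S' x → InAff f S x)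

AffIndep : ∀ {m n} → (Fin m → V n) → Subset m → Set
AffIndep f S = ∀ i → i ∈ S → ¬ InAff f (S - i) (f i)

IsBasis : ∀ {m n} → (Fin m → V n) → Subset m → Subset m → Set
IsBasis f S B = B ⊆ S × AffIndep f B × SameAff f B f S

HasDim : ∀ {m n} → (Fin m → V n) → ℕ → Set
HasDim {m} {n} f d =
  Σ (Fin (suc d) → V n) λ g → Injective _≡_ _≡_ g × AffIndep g ⊤ × SameAff g ⊤ f ⊤

IsCap : ∀ {m n} → (Fin m → V n) → Set
IsCap {n = n} f = ∀ i j k l → i ≢ j → i ≢ k → i ≢ l → j ≢ k → j ≢ l → k ≢ l →
  f i ⊕ f j ⊕ f k ⊕ f l ≢ 𝟎 n

-- Bx is a valid choice of the sets B_x (x = f i ∈ D = C ∖ B): for every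
-- index i outside B, Bx i is the (unique) odd subset of B summing to f i.
IsBxFamily : ∀ {m n} → (Fin m → V n) → Subset m → (Fin m → Subset m) → Set
IsBxFamily f B Bx = ∀ i → i ∉ B → Bx i ⊆ B × Odd ∣ Bx i ∣ × sumOver f (Bx i) ≡ f i

PairPattern : ∀ {m} → Subset m → (Fin m → Subset m) → Set
PairPattern {m} B Bx =
  ∣ ∁ B ∣ ≡ 5 ×
  (∀ i → i ∉ B → ∣ Bx i ∣ ≡ 5) ×
  Σ (Fin m) λ i → Σ (Fin m) λ j → Σ (Fin m) λ k → Σ (Fin m) λ l →
    i ∉ B × j ∉ B × k ∉ B × l ∉ B ×
    i ≢ j × i ≢ k × i ≢ l × j ≢ k × j ≢ l × k ≢ l ×
    ∣ Bx i ∩ Bx j ∣ ≡ 2 × ∣ Bx k ∩ Bx l ∣ ≡ 2 ×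
    (∀ s t → s ∉ B → t ∉ B → s ≢ t →
       ¬ ((s ≡ i × t ≡ j) ⊎ (s ≡ j × t ≡ i) ⊎ (s ≡ k × t ≡ l) ⊎ (s ≡ l × t ≡ k)) →
       ∣ Bx s ∩ Bx t ∣ ≡ 3)

-- Since C has dimension 7, every basis B has 8 points, so D = C ∖ B has 5 points, and each B_x
-- (x ∈ D) is an odd subset of B. For distinct x₁, …, x_k ∈ D the points x_i together with the
-- symmetric difference B_{x₁} ⊕ ⋯ ⊕ B_{x_k} sum to zero; as C contains no quad (and no repeated
-- point), k + ∣B_{x₁} ⊕ ⋯ ⊕ B_{x_k}∣ is neither 2 nor 4. Inclusion–exclusion inside the 8-set B
-- turns this, for k ≤ 4, into arithmetic on sizes of intersections: every ∣B_x∣ is 5 or 7, two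
-- 5-sets meet in 2 or 3 points, a 7-set meets every other B_y in 4 points, no three 5-sets meet
-- pairwise in 2, 2 and 2 or 3 points, and no four 5-sets meet pairwise in 3 points. A 7-set would
-- therefore force four 5-sets meeting pairwise in 3, so all ∣B_x∣ = 5. Finally the graph on D
-- joining x and y when ∣B_x ∩ B_y∣ = 2 has maximum degree 1 and no four independent vertices,
-- so it consists of exactly two disjoint edges.

module Submission where

open import Defs
open import Data.Bool using (Bool; true; false; not; _∧_; _∨_; _xor_; if_then_else_)
open import Data.Bool.Properties
  using (not-involutive; xor-assoc; xor-comm; xor-identityˡ; xor-identityʳ; xor-same)
import Data.Empty
open import Data.Empty using (⊥-elim)
open import Data.Fin using (Fin; zero; suc; #_; punchIn)
open import Data.Fin.Properties
  using (0≢1+n; any?; pigeonhole; <⇒≢; punchIn-injective; punchInᵢ≢i)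
  renaming (_≟_ to _≟ᶠ_; suc-injective to fsuc-injective)
open import Data.Fin.Subset using (Subset; ∁; _∈_; _∉_; _⊆_; _∩_; _∪_; _-_; ∣_∣; ⊤; ⊥; ⁅_⁆; Nonempty)
open import Data.Fin.Subset.Properties
  using ( ∉⊥; ⊥⊆; ∈⊤; ∣⊤∣≡n; ∣⊥∣≡0; x∈⁅x⁆; x∈⁅y⁆⇒x≡y; ∣⁅x⁆∣≡1; p⊆q⇒∣p∣≤∣q∣; ⊆-trans; _∈?_
        ; Empty-unique; nonempty?; p─⊥≡p; p─q⊆p; x∈p∧x≢y⇒x∈p-y; ∣∁p∣≡n∸∣p∣; x∈∁p⇒x∉p; x∉p⇒x∈∁p
        ; p∩q⊆p; x∈p∪q⁻; ∩-comm; ∩-idem)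
open import Data.Nat using (ℕ; zero; suc; _+_; _*_; _∸_; _<_; _≤_; _%_; s≤s; z≤n)
open import Data.Nat.Properties
  using ( _≟_; allUpTo?; +-comm; +-suc; *-distribˡ-+; *-zeroʳ; +-commutativeSemigroup; suc-injective
        ; <-irrefl; ≤-refl; ≤-pred; <⇒≤; ≮⇒≥; ≤-antisym)
open import Algebra.Properties.CommutativeSemigroup +-commutativeSemigroup using (interchange)
open import Data.Product using (Σ; ∃; _×_; _,_; proj₁; proj₂)
import Data.Product as Product
open import Data.Sum using (_⊎_; inj₁; inj₂)
import Data.Sum as Sum
open import Data.Vec using (Vec; []; _∷_; lookup; head; tail; tabulate; here; there)
open import Data.Vec.Functional using () renaming (_∷_ to _◂_)
open import Data.Vec.Properties
  using (∷-injective; lookup∘tabulate; zipWith-assoc; zipWith-comm; zipWith-identityˡ; zipWith-identityʳ)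
open import Data.Vec.Relation.Unary.All using (All; []; _∷_)
import Data.Vec.Relation.Unary.All.Properties as Allₚ
open import Data.Vec.Relation.Unary.AllPairs using (AllPairs; []; _∷_; allPairs?)
import Data.Vec.Relation.Unary.AllPairs as AllPairs
import Data.Vec.Relation.Unary.AllPairs.Properties as AllPairsₚ
open import Data.Vec.Relation.Unary.Unique.Propositional using (Unique)
open import Data.Vec.Relation.Unary.Unique.Propositional.Properties using (lookup-injective)
open import Function using (_∘_; id)
open import Function.Definitions using (Injective)
open import Relation.Binary.Definitions using (Decidable)
open import Relation.Binary.PropositionalEquality
open import Relation.Nullary using (¬_; ¬?; Dec; yes; no; does; contradiction; _×-dec_; _⊎-dec_; _→-dec_)
open import Relation.Nullary.Decidable using (True; toWitness; map′)

-- Vectors over Z₂ and sums of subfamilies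

⊕-assoc : ∀ {n} (x y z : V n) → (x ⊕ y) ⊕ z ≡ x ⊕ (y ⊕ z)
⊕-assoc = zipWith-assoc xor-assoc

⊕-comm : ∀ {n} (x y : V n) → x ⊕ y ≡ y ⊕ x
⊕-comm = zipWith-comm xor-comm

⊕-identityˡ : ∀ {n} (x : V n) → 𝟎 n ⊕ x ≡ x
⊕-identityˡ = zipWith-identityˡ xor-identityˡ

⊕-identityʳ : ∀ {n} (x : V n) → x ⊕ 𝟎 n ≡ x
⊕-identityʳ = zipWith-identityʳ xor-identityʳ

⊕-self : ∀ {n} (x : V n) → x ⊕ x ≡ 𝟎 n
⊕-self []      = refl
⊕-self (a ∷ x) = cong₂ _∷_ (xor-same a) (⊕-self x)

⊕≡𝟎⇒≡ : ∀ {n} {x y : V n} → x ⊕ y ≡ 𝟎 n → x ≡ y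
⊕≡𝟎⇒≡ {x = x} {y} x⊕y≡𝟎 = begin
  x            ≡⟨ ⊕-identityʳ x ⟨
  x ⊕ 𝟎 _      ≡⟨ cong (x ⊕_) (⊕-self y) ⟨
  x ⊕ (y ⊕ y)  ≡⟨ ⊕-assoc x y y ⟨
  (x ⊕ y) ⊕ y  ≡⟨ cong (_⊕ y) x⊕y≡𝟎 ⟩
  𝟎 _ ⊕ y      ≡⟨ ⊕-identityˡ y ⟩
  y            ∎
  where open ≡-Reasoning

⊕-interchange : ∀ {n} (a b c d : V n) → (a ⊕ b) ⊕ (c ⊕ d) ≡ (a ⊕ c) ⊕ (b ⊕ d)
⊕-interchange a b c d = begin
  (a ⊕ b) ⊕ (c ⊕ d)  ≡⟨ ⊕-assoc a b (c ⊕ d) ⟩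
  a ⊕ (b ⊕ (c ⊕ d))  ≡⟨ cong (a ⊕_) (⊕-assoc b c d) ⟨
  a ⊕ ((b ⊕ c) ⊕ d)  ≡⟨ cong (λ z → a ⊕ (z ⊕ d)) (⊕-comm b c) ⟩
  a ⊕ ((c ⊕ b) ⊕ d)  ≡⟨ cong (a ⊕_) (⊕-assoc c b d) ⟩
  a ⊕ (c ⊕ (b ⊕ d))  ≡⟨ ⊕-assoc a c (b ⊕ d) ⟨
  (a ⊕ c) ⊕ (b ⊕ d)  ∎
  where open ≡-Reasoning

⊕-right-nested : ∀ {n} (a b c d : V n) → a ⊕ b ⊕ c ⊕ d ≡ a ⊕ (b ⊕ (c ⊕ (d ⊕ 𝟎 n)))
⊕-right-nested a b c d = begin
  a ⊕ b ⊕ c ⊕ d                ≡⟨ ⊕-assoc (a ⊕ b) c d ⟩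
  (a ⊕ b) ⊕ (c ⊕ d)            ≡⟨ ⊕-assoc a b (c ⊕ d) ⟩
  a ⊕ (b ⊕ (c ⊕ d))            ≡⟨ cong (λ z → a ⊕ (b ⊕ (c ⊕ z))) (⊕-identityʳ d) ⟨
  a ⊕ (b ⊕ (c ⊕ (d ⊕ 𝟎 _)))    ∎
  where open ≡-Reasoning

-- Subset n and V n are both Vec Bool n; on subsets, _⊕_ is the symmetric difference.

∈-⊕⁻ : ∀ {n} {x : Fin n} (p q : Subset n) → x ∈ p ⊕ q → x ∈ p ⊎ x ∈ q
∈-⊕⁻ (true  ∷ p) (false ∷ q) here       = inj₁ here
∈-⊕⁻ (false ∷ p) (true  ∷ q) here       = inj₂ here
∈-⊕⁻ (a     ∷ p) (b     ∷ q) (there x∈) = Sum.map there there (∈-⊕⁻ p q x∈)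

∈-⊕⁺ˡ : ∀ {n} {x : Fin n} {p q : Subset n} → x ∈ p → x ∉ q → x ∈ p ⊕ q
∈-⊕⁺ˡ {p = true ∷ p} {true  ∷ q} here        x∉q = contradiction here x∉q
∈-⊕⁺ˡ {p = true ∷ p} {false ∷ q} here        x∉q = here
∈-⊕⁺ˡ {p = a ∷ p}    {b ∷ q}     (there x∈p) x∉q = there (∈-⊕⁺ˡ x∈p (x∉q ∘ there))

∈-⊕⁺ʳ : ∀ {n} {x : Fin n} {p q : Subset n} → x ∉ p → x ∈ q → x ∈ p ⊕ q
∈-⊕⁺ʳ {p = p} {q} x∉p x∈q = subst (_ ∈_) (⊕-comm q p) (∈-⊕⁺ˡ x∈q x∉p)

∈-∈-⊕ : ∀ {n} {x : Fin n} {p q : Subset n} → x ∈ p → x ∈ q → x ∉ p ⊕ q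
∈-∈-⊕ {p = true ∷ p} {true ∷ q} here        here        ()
∈-∈-⊕ {p = a ∷ p}    {b ∷ q}    (there x∈p) (there x∈q) (there x∈) = ∈-∈-⊕ x∈p x∈q x∈

⊕-⊆ : ∀ {n} {p q r : Subset n} → p ⊆ r → q ⊆ r → p ⊕ q ⊆ r
⊕-⊆ {p = p} {q} p⊆r q⊆r x∈ = Sum.[ p⊆r , q⊆r ]′ (∈-⊕⁻ p q x∈)

∪-⊆ : ∀ {n} {p q r : Subset n} → p ⊆ r → q ⊆ r → p ∪ q ⊆ r
∪-⊆ {p = p} {q} p⊆r q⊆r x∈ = Sum.[ p⊆r , q⊆r ]′ (x∈p∪q⁻ p q x∈)

⁅⁆⊆ : ∀ {n} {x : Fin n} {p} → x ∈ p → ⁅ x ⁆ ⊆ p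
⁅⁆⊆ {p = p} x∈p y∈ = subst (_∈ p) (sym (x∈⁅y⁆⇒x≡y _ y∈)) x∈p

⊆⊥⇒≡⊥ : ∀ {n} {p : Subset n} → p ⊆ ⊥ → p ≡ ⊥
⊆⊥⇒≡⊥ p⊆⊥ = Empty-unique λ (x , x∈p) → ∉⊥ (p⊆⊥ x∈p)

x∉p-x : ∀ {n} (p : Subset n) x → x ∉ p - x
x∉p-x (b ∷ p) zero    ()
x∉p-x (b ∷ p) (suc x) (there x∈) = x∉p-x p x x∈

⊆-remove : ∀ {n} {v S : Subset n} {j} → v ⊆ S → j ∉ v → v ⊆ S - j
⊆-remove {v = v} v⊆S j∉v x∈v = x∈p∧x≢y⇒x∈p-y (v⊆S x∈v) λ x≡j → j∉v (subst (_∈ v) x≡j x∈v)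

p-x⊕⁅x⁆ : ∀ {n} {p : Subset n} {x} → x ∈ p → (p - x) ⊕ ⁅ x ⁆ ≡ p
p-x⊕⁅x⁆ {p = true ∷ p} here       = cong (true ∷_) (trans (⊕-identityʳ _) (p─⊥≡p p))
p-x⊕⁅x⁆ {p = b ∷ p}    (there x∈) = cong₂ _∷_ (xor-identityʳ b) (p-x⊕⁅x⁆ x∈)

∣p⊕q∣-disjoint : ∀ {n} (p q : Subset n) → (∀ {x} → x ∈ p → x ∉ q) → ∣ p ⊕ q ∣ ≡ ∣ p ∣ + ∣ q ∣
∣p⊕q∣-disjoint []          []          _    = refl
∣p⊕q∣-disjoint (true  ∷ p) (true  ∷ q) disj = contradiction here (disj here)
∣p⊕q∣-disjoint (true  ∷ p) (false ∷ q) disj = cong suc (∣p⊕q∣-disjoint p q λ x∈ → disj (there x∈) ∘ there)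
∣p⊕q∣-disjoint (false ∷ p) (true  ∷ q) disj =
  trans (cong suc (∣p⊕q∣-disjoint p q λ x∈ → disj (there x∈) ∘ there)) (sym (+-suc _ _))
∣p⊕q∣-disjoint (false ∷ p) (false ∷ q) disj = ∣p⊕q∣-disjoint p q λ x∈ → disj (there x∈) ∘ there

∣p-x∣ : ∀ {n} {p : Subset n} {x} → x ∈ p → suc ∣ p - x ∣ ≡ ∣ p ∣
∣p-x∣ {p = p} {x} x∈p = begin
  suc ∣ p - x ∣           ≡⟨ +-comm 1 ∣ p - x ∣ ⟩
  ∣ p - x ∣ + 1           ≡⟨ cong (∣ p - x ∣ +_) (∣⁅x⁆∣≡1 x) ⟨
  ∣ p - x ∣ + ∣ ⁅ x ⁆ ∣   ≡⟨ ∣p⊕q∣-disjoint (p - x) ⁅ x ⁆ x∉ ⟨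
  ∣ (p - x) ⊕ ⁅ x ⁆ ∣     ≡⟨ cong ∣_∣ (p-x⊕⁅x⁆ x∈p) ⟩
  ∣ p ∣                   ∎
  where
  open ≡-Reasoning
  x∉ : ∀ {y} → y ∈ p - x → y ∉ ⁅ x ⁆
  x∉ y∈ y∈⁅x⁆ = x∉p-x p x (subst (_∈ p - x) (x∈⁅y⁆⇒x≡y _ y∈⁅x⁆) y∈)

nonempty-of-size : ∀ {n} {p : Subset n} → 0 < ∣ p ∣ → Nonempty p
nonempty-of-size {n} {p} 0<∣p∣ with nonempty? p
... | yes ne = ne
... | no ¬ne = contradiction 0<∣p∣ (<-irrefl (sym (trans (cong ∣_∣ (Empty-unique ¬ne)) (∣⊥∣≡0 n))))

size-zero⇒≡⊥ : ∀ {n} {p : Subset n} → ∣ p ∣ ≡ 0 → p ≡ ⊥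
size-zero⇒≡⊥ {p = p} ∣p∣≡0 = Empty-unique λ (x , x∈p) →
  contradiction (subst₂ _≤_ (∣⁅x⁆∣≡1 x) ∣p∣≡0 (p⊆q⇒∣p∣≤∣q∣ (⁅⁆⊆ x∈p))) λ ()

if-xor : ∀ {n} a b (v : V n) →
  (if a xor b then v else 𝟎 n) ≡ (if a then v else 𝟎 n) ⊕ (if b then v else 𝟎 n)
if-xor true  true  v = sym (⊕-self v)
if-xor true  false v = sym (⊕-identityʳ v)
if-xor false b     v = sym (⊕-identityˡ _)

sumOver-𝟎 : ∀ {m n} (f : Fin m → V n) → sumOver f ⊥ ≡ 𝟎 n
sumOver-𝟎 {zero}  f = refl
sumOver-𝟎 {suc m} f = trans (⊕-identityˡ _) (sumOver-𝟎 (f ∘ suc))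

sumOver-⊕ : ∀ {m n} (f : Fin m → V n) (S T : Subset m) →
  sumOver f (S ⊕ T) ≡ sumOver f S ⊕ sumOver f T
sumOver-⊕ f []      []      = sym (⊕-identityˡ _)
sumOver-⊕ f (a ∷ S) (b ∷ T) =
  trans (cong₂ _⊕_ (if-xor a b (f zero)) (sumOver-⊕ (f ∘ suc) S T)) (⊕-interchange _ _ _ _)

sumOver-⊕ᶠ : ∀ {m n} (f g : Fin m → V n) (S : Subset m) →
  sumOver (λ i → f i ⊕ g i) S ≡ sumOver f S ⊕ sumOver g S
sumOver-⊕ᶠ f g []          = sym (⊕-identityˡ _)
sumOver-⊕ᶠ f g (true ∷ S)  =
  trans (cong (f zero ⊕ g zero ⊕_) (sumOver-⊕ᶠ (f ∘ suc) (g ∘ suc) S)) (⊕-interchange _ _ _ _)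
sumOver-⊕ᶠ f g (false ∷ S) =
  trans (⊕-identityˡ _) (trans (sumOver-⊕ᶠ (f ∘ suc) (g ∘ suc) S)
    (sym (cong₂ _⊕_ (⊕-identityˡ _) (⊕-identityˡ _))))

sumOver-⁅⁆ : ∀ {m n} (f : Fin m → V n) i → sumOver f ⁅ i ⁆ ≡ f i
sumOver-⁅⁆ f zero    = trans (cong (f zero ⊕_) (sumOver-𝟎 (f ∘ suc))) (⊕-identityʳ _)
sumOver-⁅⁆ f (suc i) = trans (⊕-identityˡ _) (sumOver-⁅⁆ (f ∘ suc) i)

sumOver-cong : ∀ {m n} {f g : Fin m → V n} (S : Subset m) →
  (∀ {i} → i ∈ S → f i ≡ g i) → sumOver f S ≡ sumOver g S
sumOver-cong []          f≡g = refl
sumOver-cong (true  ∷ S) f≡g = cong₂ _⊕_ (f≡g here) (sumOver-cong S (f≡g ∘ there))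
sumOver-cong (false ∷ S) f≡g = cong (𝟎 _ ⊕_) (sumOver-cong S (f≡g ∘ there))

sumOver-sumOver : ∀ {p m n} (f : Fin m → V n) (T : Fin p → Subset m) (R : Subset p) →
  sumOver f (sumOver T R) ≡ sumOver (sumOver f ∘ T) R
sumOver-sumOver f T []      = sumOver-𝟎 f
sumOver-sumOver f T (b ∷ R) =
  trans (sumOver-⊕ f _ _) (cong₂ _⊕_ (head-term b) (sumOver-sumOver f (T ∘ suc) R))
  where
  head-term : ∀ b → sumOver f (if b then T zero else ⊥) ≡ (if b then sumOver f (T zero) else 𝟎 _)
  head-term true  = refl
  head-term false = sumOver-𝟎 f

sumOver-⊆ : ∀ {p m} (T : Fin p → Subset m) {R : Subset p} {S : Subset m} →
  (∀ {i} → i ∈ R → T i ⊆ S) → sumOver T R ⊆ S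
sumOver-⊆ T {[]}        T⊆S x∈ = contradiction x∈ ∉⊥
sumOver-⊆ T {true  ∷ R} T⊆S    = ⊕-⊆ (T⊆S here) (sumOver-⊆ (T ∘ suc) (T⊆S ∘ there))
sumOver-⊆ T {false ∷ R} T⊆S    = ⊕-⊆ ⊥⊆ (sumOver-⊆ (T ∘ suc) (T⊆S ∘ there))

-- Images and enumerations of subsets

-- The image of J under y when y is injective; otherwise repeated values cancel.
image : ∀ {k m} → (Fin k → Fin m) → Subset k → Subset m
image y J = sumOver (⁅_⁆ ∘ y) J

sumOver-image : ∀ {k m n} (f : Fin m → V n) (y : Fin k → Fin m) (J : Subset k) →
  sumOver f (image y J) ≡ sumOver (f ∘ y) J
sumOver-image f y J = trans (sumOver-sumOver f (⁅_⁆ ∘ y) J) (sumOver-cong J λ {i} _ → sumOver-⁅⁆ f (y i))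

∈-image⁻ : ∀ {k m} (y : Fin k → Fin m) (J : Subset k) {z} → z ∈ image y J → ∃ λ u → u ∈ J × y u ≡ z
∈-image⁻ y []      z∈ = contradiction z∈ ∉⊥
∈-image⁻ y (b ∷ J) z∈ with ∈-⊕⁻ (if b then ⁅ y zero ⁆ else ⊥) _ z∈
∈-image⁻ y (true  ∷ J) z∈ | inj₁ z∈⁅y₀⁆ = zero , here , sym (x∈⁅y⁆⇒x≡y _ z∈⁅y₀⁆)
∈-image⁻ y (false ∷ J) z∈ | inj₁ z∈⊥    = contradiction z∈⊥ ∉⊥
∈-image⁻ y (b     ∷ J) z∈ | inj₂ z∈ᵢ    =
  Product.map suc (Product.map₁ there) (∈-image⁻ (y ∘ suc) J z∈ᵢ)

module _ {k m} {y : Fin (suc k) → Fin m} (y-inj : Injective _≡_ _≡_ y) where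

  tail-injective : Injective _≡_ _≡_ (y ∘ suc)
  tail-injective = fsuc-injective ∘ y-inj

  head∉image-tail : ∀ J → y zero ∉ image (y ∘ suc) J
  head∉image-tail J y₀∈ = let (u , _ , y₁₊ᵤ≡y₀) = ∈-image⁻ (y ∘ suc) J y₀∈ in 0≢1+n (sym (y-inj y₁₊ᵤ≡y₀))

∈-image⁺ : ∀ {k m} {y : Fin k → Fin m} → Injective _≡_ _≡_ y → ∀ {J u} → u ∈ J → y u ∈ image y J
∈-image⁺ {y = y} y-inj {true ∷ J} here = ∈-⊕⁺ˡ (x∈⁅x⁆ (y zero)) (head∉image-tail y-inj J)
∈-image⁺ {y = y} y-inj {b ∷ J} {suc u} (there u∈J) =
  ∈-⊕⁺ʳ (head-term b) (∈-image⁺ (tail-injective y-inj) u∈J)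
  where
  head-term : ∀ b → y (suc u) ∉ (if b then ⁅ y zero ⁆ else ⊥)
  head-term true  y₁₊ᵤ∈ = 0≢1+n (sym (y-inj (x∈⁅y⁆⇒x≡y _ y₁₊ᵤ∈)))
  head-term false       = ∉⊥

∣image∣ : ∀ {k m} {y : Fin k → Fin m} → Injective _≡_ _≡_ y → ∀ J → ∣ image y J ∣ ≡ ∣ J ∣
∣image∣ {m = m} y-inj []          = ∣⊥∣≡0 m
∣image∣ {y = y} y-inj (true ∷ J)  =
  trans (∣p⊕q∣-disjoint ⁅ y zero ⁆ (image (y ∘ suc) J)
           λ x∈ → subst (_∉ image (y ∘ suc) J) (sym (x∈⁅y⁆⇒x≡y _ x∈)) (head∉image-tail y-inj J))
        (cong₂ _+_ (∣⁅x⁆∣≡1 (y zero)) (∣image∣ (tail-injective y-inj) J))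
∣image∣ {y = y} y-inj (false ∷ J) =
  trans (cong ∣_∣ (⊕-identityˡ (image (y ∘ suc) J))) (∣image∣ (tail-injective y-inj) J)

enumerate : ∀ {m} k (p : Subset m) → ∣ p ∣ ≡ k →
  Σ (Fin k → Fin m) λ y → Injective _≡_ _≡_ y × image y ⊤ ≡ p
enumerate zero    p ∣p∣≡0 = (λ ()) , (λ { {()} }) , sym (size-zero⇒≡⊥ ∣p∣≡0)
enumerate (suc k) p ∣p∣≡1+k with nonempty-of-size {p = p} (subst (0 <_) (sym ∣p∣≡1+k) (s≤s z≤n))
... | x , x∈p with enumerate k (p - x) (suc-injective (trans (∣p-x∣ x∈p) ∣p∣≡1+k))
... | y , y-inj , image≡p-x = (x ◂ y) , x◂y-inj , image≡p
  where
  x≢y : ∀ u → x ≢ y u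
  x≢y u x≡yu = x∉p-x p x (subst (x ∈_) image≡p-x (subst (_∈ image y ⊤) (sym x≡yu) (∈-image⁺ y-inj ∈⊤)))
  x◂y-inj : Injective _≡_ _≡_ (x ◂ y)
  x◂y-inj {zero}  {zero}  _ = refl
  x◂y-inj {zero}  {suc v} e = contradiction e (x≢y v)
  x◂y-inj {suc u} {zero}  e = contradiction (sym e) (x≢y u)
  x◂y-inj {suc u} {suc v} e = cong suc (y-inj e)
  image≡p : image (x ◂ y) ⊤ ≡ p
  image≡p = begin
    ⁅ x ⁆ ⊕ image y ⊤  ≡⟨ cong (⁅ x ⁆ ⊕_) image≡p-x ⟩
    ⁅ x ⁆ ⊕ (p - x)    ≡⟨ ⊕-comm ⁅ x ⁆ (p - x) ⟩
    (p - x) ⊕ ⁅ x ⁆    ≡⟨ p-x⊕⁅x⁆ x∈p ⟩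
    p                  ∎
    where open ≡-Reasoning

-- Linear and affine independence

-- The coefficient set of f i ⊕ [j ∈ f i] · f i₀: one step of Gaussian elimination, clearing
-- coordinate j of f i with the pivot f i₀.
clear : ∀ {p m} (f : Fin p → V m) (i₀ : Fin p) (j : Fin m) → Fin p → Subset p
clear f i₀ j i = ⁅ i ⁆ ⊕ (if does (j ∈? f i) then ⁅ i₀ ⁆ else ⊥)

module _ {p m} (f : Fin p → V m) (i₀ : Fin p) (j : Fin m) where

  private
    pivot-part : Fin p → Subset p
    pivot-part i = if does (j ∈? f i) then ⁅ i₀ ⁆ else ⊥

    pivot-part⊆⁅i₀⁆ : ∀ i → pivot-part i ⊆ ⁅ i₀ ⁆
    pivot-part⊆⁅i₀⁆ i with j ∈? f i
    ... | yes _ = id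
    ... | no  _ = ⊥⊆

  clear⊆ : ∀ {I i} → i ∈ I → i₀ ∈ I → clear f i₀ j i ⊆ I
  clear⊆ {i = i} i∈I i₀∈I = ⊕-⊆ (⁅⁆⊆ i∈I) (⊆-trans (pivot-part⊆⁅i₀⁆ i) (⁅⁆⊆ i₀∈I))

  sumOver-clear⊆ : ∀ {S i} → f i ⊆ S → f i₀ ⊆ S → j ∈ f i₀ → sumOver f (clear f i₀ j i) ⊆ S - j
  sumOver-clear⊆ {S} {i} fi⊆S fi₀⊆S j∈fi₀ with j ∈? f i
  ... | yes j∈fi = subst (_⊆ S - j) (sym Σ≡) (⊆-remove (⊕-⊆ fi⊆S fi₀⊆S) (∈-∈-⊕ j∈fi j∈fi₀))
    where
    Σ≡ : sumOver f (⁅ i ⁆ ⊕ ⁅ i₀ ⁆) ≡ f i ⊕ f i₀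
    Σ≡ = trans (sumOver-⊕ f ⁅ i ⁆ ⁅ i₀ ⁆) (cong₂ _⊕_ (sumOver-⁅⁆ f i) (sumOver-⁅⁆ f i₀))
  ... | no j∉fi = subst (_⊆ S - j) (sym Σ≡) (⊆-remove fi⊆S j∉fi)
    where
    Σ≡ : sumOver f (⁅ i ⁆ ⊕ ⊥) ≡ f i
    Σ≡ = trans (cong (sumOver f) (⊕-identityʳ ⁅ i ⁆)) (sumOver-⁅⁆ f i)

  ∈-sumOver-clear : ∀ {R r} → r ∈ R → r ≢ i₀ → r ∈ sumOver (clear f i₀ j) R
  ∈-sumOver-clear {R} {r} r∈R r≢i₀ =
    subst (r ∈_) (sym (sumOver-⊕ᶠ ⁅_⁆ pivot-part R)) (∈-⊕⁺ˡ (∈-image⁺ id r∈R) r∉)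
    where
    r∉ : r ∉ sumOver pivot-part R
    r∉ r∈ = r≢i₀ (x∈⁅y⁆⇒x≡y _ (sumOver-⊆ pivot-part (λ {i} _ → pivot-part⊆⁅i₀⁆ i) r∈))

-- Gaussian elimination: induction on ∣ S ∣, clearing one coordinate j ∈ S at a time.
linear-dependence : ∀ {p m} k (f : Fin p → V m) (I : Subset p) (S : Subset m) →
  ∣ S ∣ ≡ k → k < ∣ I ∣ → (∀ {i} → i ∈ I → f i ⊆ S) →
  ∃ λ R → R ⊆ I × Nonempty R × sumOver f R ≡ 𝟎 m
linear-dependence zero f I S ∣S∣≡0 0<∣I∣ f⊆S =
  let (r , r∈I) = nonempty-of-size 0<∣I∣ in
  ⁅ r ⁆ , ⁅⁆⊆ r∈I , (r , x∈⁅x⁆ r) ,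
  trans (sumOver-⁅⁆ f r) (⊆⊥⇒≡⊥ (subst (f r ⊆_) (size-zero⇒≡⊥ ∣S∣≡0) (f⊆S r∈I)))
linear-dependence (suc k) f I S ∣S∣≡1+k 1+k<∣I∣ f⊆S
  with nonempty-of-size {p = S} (subst (0 <_) (sym ∣S∣≡1+k) (s≤s z≤n))
... | j , j∈S with any? (λ i → i ∈? I ×-dec j ∈? f i)
...   | no no-pivot =
  linear-dependence k f I (S - j) ∣S-j∣≡k (<⇒≤ 1+k<∣I∣)
    λ i∈I → ⊆-remove (f⊆S i∈I) λ j∈fi → no-pivot (_ , i∈I , j∈fi)
  where
  ∣S-j∣≡k = suc-injective (trans (∣p-x∣ j∈S) ∣S∣≡1+k)
...   | yes (i₀ , i₀∈I , j∈fi₀) =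
  let (R′ , R′⊆I-i₀ , (r , r∈R′) , ΣR′≡𝟎) =
        linear-dependence k (sumOver f ∘ clear f i₀ j) (I - i₀) (S - j) ∣S-j∣≡k k<∣I-i₀∣
          λ i∈I-i₀ → sumOver-clear⊆ f i₀ j (f⊆S (p─q⊆p I _ i∈I-i₀)) (f⊆S i₀∈I) j∈fi₀
  in sumOver (clear f i₀ j) R′
   , sumOver-⊆ (clear f i₀ j) (λ i∈R′ → clear⊆ f i₀ j (p─q⊆p I _ (R′⊆I-i₀ i∈R′)) i₀∈I)
   , (r , ∈-sumOver-clear f i₀ j r∈R′ λ r≡i₀ → x∉p-x I i₀ (subst (_∈ I - i₀) r≡i₀ (R′⊆I-i₀ r∈R′)))
   , trans (sumOver-sumOver f (clear f i₀ j) R′) ΣR′≡𝟎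
  where
  ∣S-j∣≡k = suc-injective (trans (∣p-x∣ j∈S) ∣S∣≡1+k)
  k<∣I-i₀∣ = ≤-pred (subst (suc k <_) (sym (∣p-x∣ i₀∈I)) 1+k<∣I∣)

isOdd : ℕ → Bool
isOdd zero    = false
isOdd (suc k) = not (isOdd k)

Odd⇒isOdd : ∀ k → Odd k → isOdd k ≡ true
Odd⇒isOdd (suc zero)    _     = refl
Odd⇒isOdd (suc (suc k)) odd-k = trans (not-involutive _) (Odd⇒isOdd k odd-k)

isOdd⇒Odd : ∀ k → isOdd k ≡ true → Odd k
isOdd⇒Odd (suc zero)    _ = refl
isOdd⇒Odd (suc (suc k)) e = isOdd⇒Odd k (trans (sym (not-involutive _)) e)

-- Affine combinations of points x are the linear combinations of the lifted points (1, x).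
lift : ∀ {n} → V n → V (suc n)
lift x = true ∷ x

sumOver-lift : ∀ {m n} (f : Fin m → V n) (T : Subset m) →
  sumOver (lift ∘ f) T ≡ isOdd ∣ T ∣ ∷ sumOver f T
sumOver-lift f []          = refl
sumOver-lift f (true  ∷ T) = cong (lift (f zero) ⊕_) (sumOver-lift (f ∘ suc) T)
sumOver-lift f (false ∷ T) = cong (𝟎 _ ⊕_) (sumOver-lift (f ∘ suc) T)

InAff-self : ∀ {m n} (f : Fin m → V n) {S i} → i ∈ S → InAff f S (f i)
InAff-self f {i = i} i∈S = ⁅ i ⁆ , ⁅⁆⊆ i∈S , subst Odd (sym (∣⁅x⁆∣≡1 i)) refl , sumOver-⁅⁆ f i

AffIndep⇒no-lifted-relation : ∀ {m n} {f : Fin m → V n} {I R : Subset m} →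
  AffIndep f I → R ⊆ I → Nonempty R → sumOver (lift ∘ f) R ≢ 𝟎 (suc n)
AffIndep⇒no-lifted-relation {f = f} {I} {R} indep R⊆I (r , r∈R) ΣR≡𝟎 =
  indep r (R⊆I r∈R) (R - r , R-r⊆I-r , isOdd⇒Odd ∣ R - r ∣ (proj₁ lifted) , proj₂ lifted)
  where
  open ≡-Reasoning
  R-r⊆I-r : R - r ⊆ I - r
  R-r⊆I-r = ⊆-remove (⊆-trans (p─q⊆p R _) R⊆I) (x∉p-x R r)
  Σ≡lift : sumOver (lift ∘ f) (R - r) ≡ lift (f r)
  Σ≡lift = ⊕≡𝟎⇒≡ (begin
    sumOver (lift ∘ f) (R - r) ⊕ lift (f r)
      ≡⟨ cong (sumOver (lift ∘ f) (R - r) ⊕_) (sumOver-⁅⁆ (lift ∘ f) r) ⟨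
    sumOver (lift ∘ f) (R - r) ⊕ sumOver (lift ∘ f) ⁅ r ⁆
      ≡⟨ sumOver-⊕ (lift ∘ f) (R - r) ⁅ r ⁆ ⟨
    sumOver (lift ∘ f) ((R - r) ⊕ ⁅ r ⁆)
      ≡⟨ cong (sumOver (lift ∘ f)) (p-x⊕⁅x⁆ r∈R) ⟩
    sumOver (lift ∘ f) R
      ≡⟨ ΣR≡𝟎 ⟩
    𝟎 _ ∎)
  lifted = ∷-injective (trans (sym (sumOver-lift f (R - r))) Σ≡lift)

independent-≤-spanning : ∀ {m k n} {f : Fin m → V n} {g : Fin k → V n} {I : Subset m} {S : Subset k} →
  AffIndep f I → (∀ i → InAff g S (f i)) → ∣ I ∣ ≤ ∣ S ∣
independent-≤-spanning {n = n} {f} {g} {I} {S} indep span = ≮⇒≥ λ ∣S∣<∣I∣ →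
  let (R , R⊆I , R≠∅ , ΣT≡𝟎) = linear-dependence ∣ S ∣ T I S refl ∣S∣<∣I∣ (λ {i} _ → T⊆S i)
  in AffIndep⇒no-lifted-relation indep R⊆I R≠∅ (begin
       sumOver (lift ∘ f) R                  ≡⟨ sumOver-cong R (λ {i} _ → lift-f≡ i) ⟩
       sumOver (sumOver (lift ∘ g) ∘ T) R    ≡⟨ sumOver-sumOver (lift ∘ g) T R ⟨
       sumOver (lift ∘ g) (sumOver T R)      ≡⟨ cong (sumOver (lift ∘ g)) ΣT≡𝟎 ⟩
       sumOver (lift ∘ g) ⊥                  ≡⟨ sumOver-𝟎 (lift ∘ g) ⟩
       𝟎 (suc n)                             ∎)
  where
  open ≡-Reasoning
  T : Fin _ → Subset _
  T i = proj₁ (span i)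
  T⊆S : ∀ i → T i ⊆ S
  T⊆S i = proj₁ (proj₂ (span i))
  lift-f≡ : ∀ i → lift (f i) ≡ sumOver (lift ∘ g) (T i)
  lift-f≡ i = let (_ , _ , odd , Σ≡fi) = span i in
    sym (trans (sumOver-lift g (T i)) (cong₂ _∷_ (Odd⇒isOdd ∣ T i ∣ odd) Σ≡fi))

basis-size : ∀ {m n d} {C : Fin m → V n} {B : Subset m} → HasDim C d → IsBasis C ⊤ B → ∣ B ∣ ≡ suc d
basis-size {d = d} {C} {B} (g , _ , g-indep , aff-g≡aff-C) (_ , B-indep , aff-B≡aff-C) =
  ≤-antisym (subst (∣ B ∣ ≤_) (∣⊤∣≡n (suc d)) (independent-≤-spanning B-indep C∈aff-g))
            (subst (_≤ ∣ B ∣) (∣⊤∣≡n (suc d)) (independent-≤-spanning g-indep g∈aff-B))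
  where
  C∈aff-g : ∀ i → InAff g ⊤ (C i)
  C∈aff-g i = proj₂ (aff-g≡aff-C (C i)) (InAff-self C ∈⊤)
  g∈aff-B : ∀ k → InAff C B (g k)
  g∈aff-B k = proj₂ (aff-B≡aff-C (g k)) (proj₁ (aff-g≡aff-C (g k)) (InAff-self g ∈⊤))

basis-coordinates : ∀ {m n} {C : Fin m → V n} {B} → IsBasis C ⊤ B → Σ (Fin m → Subset m) (IsBxFamily C B)
basis-coordinates {C = C} {B} (_ , _ , aff-B≡aff-C) = (proj₁ ∘ C∈aff-B) , λ i _ → proj₂ (C∈aff-B i)
  where
  C∈aff-B : ∀ i → InAff C B (C i)
  C∈aff-B i = proj₂ (aff-B≡aff-C (C i)) (InAff-self C ∈⊤)

-- Zero sums in a cap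

TwoOrFour : ℕ → Set
TwoOrFour s = s ≡ 2 ⊎ s ≡ 4

module _ {m n} {C : Fin m → V n} (C-inj : Injective _≡_ _≡_ C) (cap : IsCap C) where

  pair-sum-≢𝟎 : (y : Fin 2 → Fin m) → Injective _≡_ _≡_ y → sumOver (C ∘ y) ⊤ ≢ 𝟎 n
  pair-sum-≢𝟎 y y-inj Σ≡𝟎 =
    0≢1+n (y-inj (C-inj (⊕≡𝟎⇒≡ (trans (cong (C (y (# 0)) ⊕_) (sym (⊕-identityʳ (C (y (# 1)))))) Σ≡𝟎))))

  quad-sum-≢𝟎 : (y : Fin 4 → Fin m) → Injective _≡_ _≡_ y → sumOver (C ∘ y) ⊤ ≢ 𝟎 n
  quad-sum-≢𝟎 y y-inj Σ≡𝟎 =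
    cap (y (# 0)) (y (# 1)) (y (# 2)) (y (# 3)) (≢ λ ()) (≢ λ ()) (≢ λ ()) (≢ λ ()) (≢ λ ()) (≢ λ ())
        (trans (⊕-right-nested _ _ _ _) Σ≡𝟎)
    where
    ≢ : ∀ {i j} → i ≢ j → y i ≢ y j
    ≢ i≢j = i≢j ∘ y-inj

  zero-sum-size : ∀ {Q} → sumOver C Q ≡ 𝟎 n → ¬ TwoOrFour ∣ Q ∣
  zero-sum-size {Q} ΣQ≡𝟎 (inj₁ ∣Q∣≡2) =
    let (y , y-inj , image≡Q) = enumerate 2 Q ∣Q∣≡2 in pair-sum-≢𝟎 y y-inj (enumerated-sum y image≡Q)
    where
    enumerated-sum : ∀ {k} (y : Fin k → Fin m) → image y ⊤ ≡ Q → sumOver (C ∘ y) ⊤ ≡ 𝟎 n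
    enumerated-sum y image≡Q = trans (sym (sumOver-image C y ⊤)) (trans (cong (sumOver C) image≡Q) ΣQ≡𝟎)
  zero-sum-size {Q} ΣQ≡𝟎 (inj₂ ∣Q∣≡4) =
    let (y , y-inj , image≡Q) = enumerate 4 Q ∣Q∣≡4 in quad-sum-≢𝟎 y y-inj (enumerated-sum y image≡Q)
    where
    enumerated-sum : ∀ {k} (y : Fin k → Fin m) → image y ⊤ ≡ Q → sumOver (C ∘ y) ⊤ ≡ 𝟎 n
    enumerated-sum y image≡Q = trans (sym (sumOver-image C y ⊤)) (trans (cong (sumOver C) image≡Q) ΣQ≡𝟎)

  -- The points y u together with the symmetric difference of the B_{y u} sum to zero, and these
  -- two parts are disjoint since the first lies outside B and the second inside.
  outside-points-constraint : ∀ {B Bx} → IsBxFamily C B Bx →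
    ∀ {k} (y : Fin k → Fin m) → Injective _≡_ _≡_ y → (∀ u → y u ∉ B) →
    ¬ TwoOrFour (k + ∣ sumOver (Bx ∘ y) ⊤ ∣)
  outside-points-constraint {B} {Bx} fam {k} y y-inj y∉B = zero-sum-size ΣQ≡𝟎 ∘ subst TwoOrFour (sym ∣Q∣≡)
    where
    open ≡-Reasoning
    Q : Subset m
    Q = image y ⊤ ⊕ sumOver (Bx ∘ y) ⊤
    ΣQ≡𝟎 : sumOver C Q ≡ 𝟎 n
    ΣQ≡𝟎 = begin
      sumOver C Q
        ≡⟨ sumOver-⊕ C _ _ ⟩
      sumOver C (image y ⊤) ⊕ sumOver C (sumOver (Bx ∘ y) ⊤)
        ≡⟨ cong₂ _⊕_ (sumOver-image C y ⊤) (sumOver-sumOver C (Bx ∘ y) ⊤) ⟩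
      sumOver (C ∘ y) ⊤ ⊕ sumOver (sumOver C ∘ Bx ∘ y) ⊤
        ≡⟨ cong (sumOver (C ∘ y) ⊤ ⊕_) (sumOver-cong ⊤ λ {u} _ → proj₂ (proj₂ (fam (y u) (y∉B u)))) ⟩
      sumOver (C ∘ y) ⊤ ⊕ sumOver (C ∘ y) ⊤
        ≡⟨ ⊕-self _ ⟩
      𝟎 n ∎
    Bx-sum⊆B : sumOver (Bx ∘ y) ⊤ ⊆ B
    Bx-sum⊆B = sumOver-⊆ (Bx ∘ y) λ {u} _ → proj₁ (fam (y u) (y∉B u))
    disjoint : ∀ {x} → x ∈ image y ⊤ → x ∉ sumOver (Bx ∘ y) ⊤
    disjoint x∈ = let (u , _ , yu≡x) = ∈-image⁻ y ⊤ x∈ in subst (_∉ B) yu≡x (y∉B u) ∘ Bx-sum⊆B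
    ∣Q∣≡ : ∣ Q ∣ ≡ k + ∣ sumOver (Bx ∘ y) ⊤ ∣
    ∣Q∣≡ = trans (∣p⊕q∣-disjoint (image y ⊤) _ disjoint)
                 (cong (_+ ∣ sumOver (Bx ∘ y) ⊤ ∣) (trans (∣image∣ y-inj ⊤) (∣⊤∣≡n k)))

-- Inclusion–exclusion by counting columns

infixr 7 _∩ᵛ_
infixr 6 _∪ᵛ_ _⊕ᵛ_
infixl 6 _+ᶜ_
infixl 7 _*ᶜ_

-- Boolean combinations of k sets and linear combinations of their sizes, as syntax, so that an
-- identity between such sizes can be checked on each of the 2^k possible columns of memberships.
data Venn (k : ℕ) : Set where
  var            : Fin k → Venn k
  ∅              : Venn k
  _∩ᵛ_ _∪ᵛ_ _⊕ᵛ_ : Venn k → Venn k → Venn k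

data Count (k : ℕ) : Set where
  ∣_∣ᶜ : Venn k → Count k
  _+ᶜ_ : Count k → Count k → Count k
  _*ᶜ_ : ℕ → Count k → Count k

⟦_⟧ : ∀ {k m} → Venn k → (Fin k → Subset m) → Subset m
⟦ var i ⟧  X = X i
⟦ ∅ ⟧      X = ⊥
⟦ e ∩ᵛ f ⟧ X = ⟦ e ⟧ X ∩ ⟦ f ⟧ X
⟦ e ∪ᵛ f ⟧ X = ⟦ e ⟧ X ∪ ⟦ f ⟧ X
⟦ e ⊕ᵛ f ⟧ X = ⟦ e ⟧ X ⊕ ⟦ f ⟧ X

⟦_⟧ᶜ : ∀ {k m} → Count k → (Fin k → Subset m) → ℕ
⟦ ∣ e ∣ᶜ ⟧ᶜ X = ∣ ⟦ e ⟧ X ∣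
⟦ c +ᶜ d ⟧ᶜ X = ⟦ c ⟧ᶜ X + ⟦ d ⟧ᶜ X
⟦ a *ᶜ c ⟧ᶜ X = a * ⟦ c ⟧ᶜ X

⟦_⟧ᵇ : ∀ {k} → Venn k → Vec Bool k → Bool
⟦ var i ⟧ᵇ  b = lookup b i
⟦ ∅ ⟧ᵇ      b = false
⟦ e ∩ᵛ f ⟧ᵇ b = ⟦ e ⟧ᵇ b ∧ ⟦ f ⟧ᵇ b
⟦ e ∪ᵛ f ⟧ᵇ b = ⟦ e ⟧ᵇ b ∨ ⟦ f ⟧ᵇ b
⟦ e ⊕ᵛ f ⟧ᵇ b = ⟦ e ⟧ᵇ b xor ⟦ f ⟧ᵇ b

⟦_⟧ᶜᵇ : ∀ {k} → Count k → Vec Bool k → ℕ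
⟦ ∣ e ∣ᶜ ⟧ᶜᵇ b = if ⟦ e ⟧ᵇ b then 1 else 0
⟦ c +ᶜ d ⟧ᶜᵇ b = ⟦ c ⟧ᶜᵇ b + ⟦ d ⟧ᶜᵇ b
⟦ a *ᶜ c ⟧ᶜᵇ b = a * ⟦ c ⟧ᶜᵇ b

module _ {k m} (X : Fin k → Subset (suc m)) where

  heads : Vec Bool k
  heads = tabulate (head ∘ X)

  tails : Fin k → Subset m
  tails = tail ∘ X

  ⟦⟧-∷ : ∀ e → ⟦ e ⟧ X ≡ ⟦ e ⟧ᵇ heads ∷ ⟦ e ⟧ tails
  ⟦⟧-∷ (var i)  = trans (head-∷-tail (X i)) (cong (_∷ tail (X i)) (sym (lookup∘tabulate (head ∘ X) i)))
    where
    head-∷-tail : (v : Subset (suc m)) → v ≡ head v ∷ tail v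
    head-∷-tail (_ ∷ _) = refl
  ⟦⟧-∷ ∅        = refl
  ⟦⟧-∷ (e ∩ᵛ f) = cong₂ _∩_ (⟦⟧-∷ e) (⟦⟧-∷ f)
  ⟦⟧-∷ (e ∪ᵛ f) = cong₂ _∪_ (⟦⟧-∷ e) (⟦⟧-∷ f)
  ⟦⟧-∷ (e ⊕ᵛ f) = cong₂ _⊕_ (⟦⟧-∷ e) (⟦⟧-∷ f)

  ⟦⟧ᶜ-∷ : ∀ c → ⟦ c ⟧ᶜ X ≡ ⟦ c ⟧ᶜᵇ heads + ⟦ c ⟧ᶜ tails
  ⟦⟧ᶜ-∷ ∣ e ∣ᶜ   = trans (cong ∣_∣ (⟦⟧-∷ e)) (∣∷∣ (⟦ e ⟧ᵇ heads) (⟦ e ⟧ tails))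
    where
    ∣∷∣ : ∀ b (p : Subset m) → ∣ b ∷ p ∣ ≡ (if b then 1 else 0) + ∣ p ∣
    ∣∷∣ true  p = refl
    ∣∷∣ false p = refl
  ⟦⟧ᶜ-∷ (c +ᶜ d) = trans (cong₂ _+_ (⟦⟧ᶜ-∷ c) (⟦⟧ᶜ-∷ d))
                     (interchange (⟦ c ⟧ᶜᵇ heads) (⟦ c ⟧ᶜ tails) (⟦ d ⟧ᶜᵇ heads) (⟦ d ⟧ᶜ tails))
  ⟦⟧ᶜ-∷ (a *ᶜ c) = trans (cong (a *_) (⟦⟧ᶜ-∷ c)) (*-distribˡ-+ a (⟦ c ⟧ᶜᵇ heads) (⟦ c ⟧ᶜ tails))

⟦⟧ᶜ-[] : ∀ {k} (c : Count k) (X : Fin k → Subset 0) → ⟦ c ⟧ᶜ X ≡ 0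
⟦⟧ᶜ-[] ∣ e ∣ᶜ   X with ⟦ e ⟧ X
... | [] = refl
⟦⟧ᶜ-[] (c +ᶜ d) X = cong₂ _+_ (⟦⟧ᶜ-[] c X) (⟦⟧ᶜ-[] d X)
⟦⟧ᶜ-[] (a *ᶜ c) X = trans (cong (a *_) (⟦⟧ᶜ-[] c X)) (*-zeroʳ a)

Agree : ∀ {k} → Count k → Count k → Set
Agree l r = ∀ b → ⟦ l ⟧ᶜᵇ b ≡ ⟦ r ⟧ᶜᵇ b

all-columns? : ∀ {k} {P : Vec Bool k → Set} → (∀ b → Dec (P b)) → Dec (∀ b → P b)
all-columns? {zero}  P? = map′ (λ { p [] → p }) (λ h → h []) (P? [])
all-columns? {suc k} P? =
  map′ (λ { (t , f) (true ∷ b) → t b ; (t , f) (false ∷ b) → f b })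
       (λ h → (h ∘ (true ∷_)) , (h ∘ (false ∷_)))
       (all-columns? (P? ∘ (true ∷_)) ×-dec all-columns? (P? ∘ (false ∷_)))

agree? : ∀ {k} (l r : Count k) → Dec (Agree l r)
agree? l r = all-columns? λ b → ⟦ l ⟧ᶜᵇ b ≟ ⟦ r ⟧ᶜᵇ b

agree⇒equal : ∀ {k} (l r : Count k) → Agree l r → ∀ {m} (X : Fin k → Subset m) → ⟦ l ⟧ᶜ X ≡ ⟦ r ⟧ᶜ X
agree⇒equal l r agree {zero}  X = trans (⟦⟧ᶜ-[] l X) (sym (⟦⟧ᶜ-[] r X))
agree⇒equal l r agree {suc m} X = begin
  ⟦ l ⟧ᶜ X                              ≡⟨ ⟦⟧ᶜ-∷ X l ⟩
  ⟦ l ⟧ᶜᵇ (heads X) + ⟦ l ⟧ᶜ (tails X)  ≡⟨ cong₂ _+_ (agree (heads X)) (agree⇒equal l r agree (tails X)) ⟩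
  ⟦ r ⟧ᶜᵇ (heads X) + ⟦ r ⟧ᶜ (tails X)  ≡⟨ ⟦⟧ᶜ-∷ X r ⟨
  ⟦ r ⟧ᶜ X                              ∎
  where open ≡-Reasoning

venn : ∀ {k} (l r : Count k) {_ : True (agree? l r)} {m} (X : Fin k → Subset m) → ⟦ l ⟧ᶜ X ≡ ⟦ r ⟧ᶜ X
venn l r {agree} = agree⇒equal l r (toWitness agree)

⟦⟧⊆ : ∀ {k m} {X : Fin k → Subset m} {S} → (∀ i → X i ⊆ S) → ∀ e → ⟦ e ⟧ X ⊆ S
⟦⟧⊆ X⊆S (var i)  = X⊆S i
⟦⟧⊆ X⊆S ∅        = ⊥⊆
⟦⟧⊆ X⊆S (e ∩ᵛ f) = ⊆-trans (p∩q⊆p _ _) (⟦⟧⊆ X⊆S e)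
⟦⟧⊆ X⊆S (e ∪ᵛ f) = ∪-⊆ (⟦⟧⊆ X⊆S e) (⟦⟧⊆ X⊆S f)
⟦⟧⊆ X⊆S (e ⊕ᵛ f) = ⊕-⊆ (⟦⟧⊆ X⊆S e) (⟦⟧⊆ X⊆S f)

x₀ : ∀ {k} → Venn (1 + k)
x₀ = var (# 0)

x₁ : ∀ {k} → Venn (2 + k)
x₁ = var (# 1)

x₂ : ∀ {k} → Venn (3 + k)
x₂ = var (# 2)

x₃ : ∀ {k} → Venn (4 + k)
x₃ = var (# 3)

-- Arithmetic of intersection sizes

-- What inclusion–exclusion inside an 8-set and the cap condition say about two, three or four of
-- the sets B_x: Σa is the sum of their sizes, c (Σc) of their pairwise intersections, t (Σt) of
-- their triple intersections, and q is the size of the intersection of all four.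
record PairCounts (Σa c : ℕ) : Set where
  field
    symdiff union : ℕ
    c<9           : c < 9
    symdiff<9     : symdiff < 9
    union<9       : union < 9
    symdiff-eq    : symdiff + 2 * c ≡ Σa
    union-eq      : union + c ≡ Σa
    allowed       : ¬ TwoOrFour (2 + symdiff)

record TripleCounts (Σa Σc t : ℕ) : Set where
  field
    symdiff union : ℕ
    t<9           : t < 9
    symdiff<9     : symdiff < 9
    union<9       : union < 9
    symdiff-eq    : symdiff + 2 * Σc ≡ Σa + 4 * t
    union-eq      : union + Σc ≡ Σa + t
    allowed       : ¬ TwoOrFour (3 + symdiff)

record QuadCounts (Σa Σc Σt : ℕ) : Set where
  field
    q symdiff union : ℕ
    q<9             : q < 9
    symdiff<9       : symdiff < 9
    union<9         : union < 9
    symdiff-eq      : symdiff + 2 * Σc + 8 * q ≡ Σa + 4 * Σt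
    union-eq        : union + Σc + q ≡ Σa + Σt
    allowed         : ¬ TwoOrFour (4 + symdiff)

twoOrFour? : ∀ s → Dec (TwoOrFour s)
twoOrFour? s = s ≟ 2 ⊎-dec s ≟ 4

-- All the arithmetic is settled by exhaustive search over the values 0, …, 8.
∀<9 : ∀ {P : ℕ → Set} → (∀ x → Dec (P x)) → Dec (∀ {x} → x < 9 → P x)
∀<9 P? = allUpTo? P? 9

never : ℕ → Dec Data.Empty.⊥
never _ = no id

odd-size-5-or-7 : ∀ {a} → a < 9 → Odd a → ¬ TwoOrFour (1 + a) → a ≡ 5 ⊎ a ≡ 7
odd-size-5-or-7 = toWitness {a? = ∀<9 λ a →
  (a % 2 ≟ 1) →-dec ¬? (twoOrFour? (1 + a)) →-dec (a ≟ 5 ⊎-dec a ≟ 7)} _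

pair-arithmetic : ∀ Σa {G : ℕ → Set} (G? : ∀ c → Dec (G c)) →
  {_ : True (∀<9 λ c → ∀<9 λ d → ∀<9 λ u →
     (d + 2 * c ≟ Σa) →-dec (u + c ≟ Σa) →-dec ¬? (twoOrFour? (2 + d)) →-dec G? c)} →
  ∀ {c} → PairCounts Σa c → G c
pair-arithmetic Σa G? {ok} counts = toWitness ok c<9 symdiff<9 union<9 symdiff-eq union-eq allowed
  where open PairCounts counts

triple-arithmetic : ∀ Σa Σc {G : ℕ → Set} (G? : ∀ t → Dec (G t)) →
  {_ : True (∀<9 λ t → ∀<9 λ d → ∀<9 λ u →
     (d + 2 * Σc ≟ Σa + 4 * t) →-dec (u + Σc ≟ Σa + t) →-dec ¬? (twoOrFour? (3 + d)) →-dec G? t)} →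
  ∀ {t} → TripleCounts Σa Σc t → G t
triple-arithmetic Σa Σc G? {ok} counts = toWitness ok t<9 symdiff<9 union<9 symdiff-eq union-eq allowed
  where open TripleCounts counts

quad-arithmetic : ∀ Σa Σc Σt →
  {_ : True (∀<9 λ q → ∀<9 λ d → ∀<9 λ u →
     (d + 2 * Σc + 8 * q ≟ Σa + 4 * Σt) →-dec (u + Σc + q ≟ Σa + Σt) →-dec twoOrFour? (4 + d))} →
  ¬ QuadCounts Σa Σc Σt
quad-arithmetic Σa Σc Σt {ok} counts = allowed (toWitness ok q<9 symdiff<9 union<9 symdiff-eq union-eq)
  where open QuadCounts counts

fives-meet-in-2-or-3 : ∀ {c} → PairCounts (5 + 5) c → c ≡ 2 ⊎ c ≡ 3
fives-meet-in-2-or-3 = pair-arithmetic (5 + 5) λ c → c ≟ 2 ⊎-dec c ≟ 3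

five-seven-meet-in-4 : ∀ {c} → PairCounts (5 + 7) c → c ≡ 4
five-seven-meet-in-4 = pair-arithmetic (5 + 7) (_≟ 4)

no-two-sevens : ∀ {c} → ¬ PairCounts (7 + 7) c
no-two-sevens = pair-arithmetic (7 + 7) never

no-seven-meeting-4-4-2 : ∀ {t} → ¬ TripleCounts (7 + 5 + 5) (4 + 4 + 2) t
no-seven-meeting-4-4-2 = triple-arithmetic (7 + 5 + 5) (4 + 4 + 2) never

no-path-of-2s : ∀ {c t} → c ≡ 2 ⊎ c ≡ 3 → ¬ TripleCounts (5 + 5 + 5) (2 + c + 2) t
no-path-of-2s (inj₁ refl) = triple-arithmetic (5 + 5 + 5) (2 + 2 + 2) never
no-path-of-2s (inj₂ refl) = triple-arithmetic (5 + 5 + 5) (2 + 3 + 2) never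

threes-meet-in-2 : ∀ {t} → TripleCounts (5 + 5 + 5) (3 + 3 + 3) t → t ≡ 2
threes-meet-in-2 = triple-arithmetic (5 + 5 + 5) (3 + 3 + 3) (_≟ 2)

no-four-threes : ¬ QuadCounts (5 + 5 + 5 + 5) (3 + 3 + 3 + 3 + 3 + 3) (2 + 2 + 2 + 2)
no-four-threes = quad-arithmetic (5 + 5 + 5 + 5) (3 + 3 + 3 + 3 + 3 + 3) (2 + 2 + 2 + 2)

-- Graphs on five vertices

unique⇒injective : ∀ {k m} {xs : Vec (Fin m) k} → Unique xs → Injective _≡_ _≡_ (lookup xs)
unique⇒injective xs! = lookup-injective xs! _ _

no-unique-beyond : ∀ {m n} → m < n → (xs : Vec (Fin m) n) → ¬ Unique xs
no-unique-beyond m<n xs xs! =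
  let (i , j , i<j , xsᵢ≡xsⱼ) = pigeonhole m<n (lookup xs) in <⇒≢ i<j (lookup-injective xs! i j xsᵢ≡xsⱼ)

distinct : ∀ {m k} (xs : Vec (Fin m) k) {_ : True (allPairs? (λ x y → ¬? (x ≟ᶠ y)) xs)} → Unique xs
distinct xs {xs!} = toWitness xs!

Matched : ∀ {A : Set} (i j k l s t : A) → Set
Matched i j k l s t = (s ≡ i × t ≡ j) ⊎ (s ≡ j × t ≡ i) ⊎ (s ≡ k × t ≡ l) ⊎ (s ≡ l × t ≡ k)

Matched-map : ∀ {X Y : Set} (f : X → Y) {i j k l s t} →
  Matched i j k l s t → Matched (f i) (f j) (f k) (f l) (f s) (f t)
Matched-map f (inj₁ (refl , refl))               = inj₁ (refl , refl)
Matched-map f (inj₂ (inj₁ (refl , refl)))        = inj₂ (inj₁ (refl , refl))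
Matched-map f (inj₂ (inj₂ (inj₁ (refl , refl)))) = inj₂ (inj₂ (inj₁ (refl , refl)))
Matched-map f (inj₂ (inj₂ (inj₂ (refl , refl)))) = inj₂ (inj₂ (inj₂ (refl , refl)))

module TwoDisjointEdges {_~_ : Fin 5 → Fin 5 → Set} (_~?_ : Decidable _~_)
  (~-sym : ∀ {u v} → u ~ v → v ~ u) (~-irrefl : ∀ {u} → ¬ u ~ u)
  (no-path : ∀ {u v w} → u ≢ w → u ~ v → ¬ v ~ w)
  (no-independent-4 : ∀ {u v w z} → Unique (u ∷ v ∷ w ∷ z ∷ []) →
                      ¬ AllPairs (λ x y → ¬ x ~ y) (u ∷ v ∷ w ∷ z ∷ []))
  where

  neighbour-unique : ∀ {u v w} → u ~ v → u ~ w → v ≡ w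
  neighbour-unique {v = v} {w} u~v u~w with v ≟ᶠ w
  ... | yes v≡w = v≡w
  ... | no  v≢w = ⊥-elim (no-path v≢w (~-sym u~v) u~w)

  edge-among : ∀ {p q r s} → Unique (p ∷ q ∷ r ∷ s ∷ []) →
    p ~ q ⊎ p ~ r ⊎ p ~ s ⊎ q ~ r ⊎ q ~ s ⊎ r ~ s
  edge-among {p} {q} {r} {s} pqrs! with p ~? q | p ~? r | p ~? s | q ~? r | q ~? s | r ~? s
  ... | yes e | _     | _     | _     | _     | _     = inj₁ e
  ... | no _  | yes e | _     | _     | _     | _     = inj₂ (inj₁ e)
  ... | no _  | no _  | yes e | _     | _     | _     = inj₂ (inj₂ (inj₁ e))
  ... | no _  | no _  | no _  | yes e | _     | _     = inj₂ (inj₂ (inj₂ (inj₁ e)))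
  ... | no _  | no _  | no _  | no _  | yes e | _     = inj₂ (inj₂ (inj₂ (inj₂ (inj₁ e))))
  ... | no _  | no _  | no _  | no _  | no _  | yes e = inj₂ (inj₂ (inj₂ (inj₂ (inj₂ e))))
  ... | no pq | no pr | no ps | no qr | no qs | no rs =
    ⊥-elim (no-independent-4 pqrs! ((pq ∷ pr ∷ ps ∷ []) ∷ (qr ∷ qs ∷ []) ∷ (rs ∷ []) ∷ [] ∷ []))

  module _ {i j k l} (ijkl! : Unique (i ∷ j ∷ k ∷ l ∷ [])) (i~j : i ~ j) (k~l : k ~ l) where

    -- An edge u ~ v with u, v ∉ {i, j, k, l} would give six distinct vertices.
    no-other-edge : ∀ {u v} → All (u ≢_) (i ∷ j ∷ k ∷ l ∷ []) → ¬ u ~ v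
    no-other-edge {u} {v} u∉@(u≢i ∷ u≢j ∷ u≢k ∷ u≢l ∷ []) u~v with v ≟ᶠ i | v ≟ᶠ j | v ≟ᶠ k | v ≟ᶠ l
    ... | yes refl | _        | _        | _        = u≢j (neighbour-unique (~-sym u~v) i~j)
    ... | no _     | yes refl | _        | _        = u≢i (neighbour-unique (~-sym u~v) (~-sym i~j))
    ... | no _     | no _     | yes refl | _        = u≢l (neighbour-unique (~-sym u~v) k~l)
    ... | no _     | no _     | no _     | yes refl = u≢k (neighbour-unique (~-sym u~v) (~-sym k~l))
    ... | no v≢i   | no v≢j   | no v≢k   | no v≢l   =
      no-unique-beyond ≤-refl (u ∷ v ∷ i ∷ j ∷ k ∷ l ∷ [])
        (((λ { refl → ~-irrefl u~v }) ∷ u∉) ∷ (v≢i ∷ v≢j ∷ v≢k ∷ v≢l ∷ []) ∷ ijkl!)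

    only-matched-edges : ∀ {u v} → u ~ v → Matched i j k l u v
    only-matched-edges {u} {v} u~v with u ≟ᶠ i | u ≟ᶠ j | u ≟ᶠ k | u ≟ᶠ l
    ... | yes refl | _        | _        | _        = inj₁ (refl , neighbour-unique u~v i~j)
    ... | no _     | yes refl | _        | _        = inj₂ (inj₁ (refl , neighbour-unique u~v (~-sym i~j)))
    ... | no _     | no _     | yes refl | _        = inj₂ (inj₂ (inj₁ (refl , neighbour-unique u~v k~l)))
    ... | no _     | no _     | no _     | yes refl = inj₂ (inj₂ (inj₂ (refl , neighbour-unique u~v (~-sym k~l))))
    ... | no u≢i   | no u≢j   | no u≢k   | no u≢l   = ⊥-elim (no-other-edge (u≢i ∷ u≢j ∷ u≢k ∷ u≢l ∷ []) u~v)

  TwoEdges : Set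
  TwoEdges = Σ (Fin 5) λ i → Σ (Fin 5) λ j → Σ (Fin 5) λ k → Σ (Fin 5) λ l →
    Unique (i ∷ j ∷ k ∷ l ∷ []) × i ~ j × k ~ l × (∀ {u v} → u ~ v → Matched i j k l u v)

  two-edges : ∀ {i j k l} → Unique (i ∷ j ∷ k ∷ l ∷ []) → i ~ j → k ~ l → TwoEdges
  two-edges ijkl! i~j k~l = _ , _ , _ , _ , ijkl! , i~j , k~l , only-matched-edges ijkl! i~j k~l

  second-edge : ∀ {i j p q r} → Unique (i ∷ j ∷ p ∷ q ∷ r ∷ []) → i ~ j → TwoEdges
  second-edge ((i≢j ∷ i≢p ∷ i≢q ∷ i≢r ∷ []) ∷ (j≢p ∷ j≢q ∷ j≢r ∷ []) ∷ (p≢q ∷ p≢r ∷ []) ∷ (q≢r ∷ []) ∷ [] ∷ []) i~j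
    with edge-among ((i≢p ∷ i≢q ∷ i≢r ∷ []) ∷ (p≢q ∷ p≢r ∷ []) ∷ (q≢r ∷ []) ∷ [] ∷ [])
  ... | inj₁ i~p                             = ⊥-elim (j≢p (neighbour-unique i~j i~p))
  ... | inj₂ (inj₁ i~q)                      = ⊥-elim (j≢q (neighbour-unique i~j i~q))
  ... | inj₂ (inj₂ (inj₁ i~r))               = ⊥-elim (j≢r (neighbour-unique i~j i~r))
  ... | inj₂ (inj₂ (inj₂ (inj₁ p~q)))        =
    two-edges ((i≢j ∷ i≢p ∷ i≢q ∷ []) ∷ (j≢p ∷ j≢q ∷ []) ∷ (p≢q ∷ []) ∷ [] ∷ []) i~j p~q
  ... | inj₂ (inj₂ (inj₂ (inj₂ (inj₁ p~r)))) =
    two-edges ((i≢j ∷ i≢p ∷ i≢r ∷ []) ∷ (j≢p ∷ j≢r ∷ []) ∷ (p≢r ∷ []) ∷ [] ∷ []) i~j p~r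
  ... | inj₂ (inj₂ (inj₂ (inj₂ (inj₂ q~r)))) =
    two-edges ((i≢j ∷ i≢q ∷ i≢r ∷ []) ∷ (j≢q ∷ j≢r ∷ []) ∷ (q≢r ∷ []) ∷ [] ∷ []) i~j q~r

  two-disjoint-edges : TwoEdges
  two-disjoint-edges with edge-among (distinct (# 0 ∷ # 1 ∷ # 2 ∷ # 3 ∷ []))
  ... | inj₁ 0~1                             = second-edge (distinct (# 0 ∷ # 1 ∷ # 2 ∷ # 3 ∷ # 4 ∷ [])) 0~1
  ... | inj₂ (inj₁ 0~2)                      = second-edge (distinct (# 0 ∷ # 2 ∷ # 1 ∷ # 3 ∷ # 4 ∷ [])) 0~2
  ... | inj₂ (inj₂ (inj₁ 0~3))               = second-edge (distinct (# 0 ∷ # 3 ∷ # 1 ∷ # 2 ∷ # 4 ∷ [])) 0~3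
  ... | inj₂ (inj₂ (inj₂ (inj₁ 1~2)))        = second-edge (distinct (# 1 ∷ # 2 ∷ # 0 ∷ # 3 ∷ # 4 ∷ [])) 1~2
  ... | inj₂ (inj₂ (inj₂ (inj₂ (inj₁ 1~3)))) = second-edge (distinct (# 1 ∷ # 3 ∷ # 0 ∷ # 2 ∷ # 4 ∷ [])) 1~3
  ... | inj₂ (inj₂ (inj₂ (inj₂ (inj₂ 2~3)))) = second-edge (distinct (# 2 ∷ # 3 ∷ # 0 ∷ # 1 ∷ # 4 ∷ [])) 2~3

-- Five odd subsets of an eight-element set

-- A u stands for B_x at the u-th point x of D = C ∖ B; `constraint' is what the cap condition says
-- about distinct points of D.
module FiveOddSets {m} {B : Subset m} (∣B∣≡8 : ∣ B ∣ ≡ 8) (A : Fin 5 → Subset m)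
  (A⊆B : ∀ u → A u ⊆ B) (A-odd : ∀ u → Odd ∣ A u ∣)
  (constraint : ∀ {k} (y : Fin k → Fin 5) → Injective _≡_ _≡_ y → ¬ TwoOrFour (k + ∣ sumOver (A ∘ y) ⊤ ∣))
  where

  a : Fin 5 → ℕ
  a u = ∣ A u ∣

  c : Fin 5 → Fin 5 → ℕ
  c u v = ∣ A u ∩ A v ∣

  t : Fin 5 → Fin 5 → Fin 5 → ℕ
  t u v w = ∣ A u ∩ A v ∩ A w ∣

  ∣⟦⟧∣<9 : ∀ {k} (y : Fin k → Fin 5) (e : Venn k) → ∣ ⟦ e ⟧ (A ∘ y) ∣ < 9
  ∣⟦⟧∣<9 y e = s≤s (subst (∣ ⟦ e ⟧ (A ∘ y) ∣ ≤_) ∣B∣≡8 (p⊆q⇒∣p∣≤∣q∣ (⟦⟧⊆ (A⊆B ∘ y) e)))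

  size-5-or-7 : ∀ u → a u ≡ 5 ⊎ a u ≡ 7
  size-5-or-7 u = odd-size-5-or-7 (∣⟦⟧∣<9 y x₀) (A-odd u)
    (subst (¬_ ∘ TwoOrFour ∘ suc) (cong ∣_∣ (⊕-identityʳ (A u))) (constraint y (unique⇒injective ([] ∷ []))))
    where
    y = lookup (u ∷ [])

  pair-counts : ∀ {u v α β} → u ≢ v → a u ≡ α → a v ≡ β → PairCounts (α + β) (c u v)
  pair-counts {u} {v} u≢v refl refl = record
    { symdiff    = ∣ ⟦ Δ ⟧ X ∣
    ; union      = ∣ ⟦ ∇ ⟧ X ∣
    ; c<9        = ∣⟦⟧∣<9 y (x₀ ∩ᵛ x₁)
    ; symdiff<9  = ∣⟦⟧∣<9 y Δ
    ; union<9    = ∣⟦⟧∣<9 y ∇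
    ; symdiff-eq = venn (∣ Δ ∣ᶜ +ᶜ 2 *ᶜ ∣ x₀ ∩ᵛ x₁ ∣ᶜ) (∣ x₀ ∣ᶜ +ᶜ ∣ x₁ ∣ᶜ) X
    ; union-eq   = venn (∣ ∇ ∣ᶜ +ᶜ ∣ x₀ ∩ᵛ x₁ ∣ᶜ) (∣ x₀ ∣ᶜ +ᶜ ∣ x₁ ∣ᶜ) X
    ; allowed    = constraint y (unique⇒injective ((u≢v ∷ []) ∷ [] ∷ []))
    }
    where
    y = lookup (u ∷ v ∷ [])
    X = A ∘ y
    Δ ∇ : Venn 2
    Δ = x₀ ⊕ᵛ x₁ ⊕ᵛ ∅
    ∇ = x₀ ∪ᵛ x₁

  triple-counts : ∀ {u v w α₁ α₂ α₃ γ₁₂ γ₁₃ γ₂₃} → Unique (u ∷ v ∷ w ∷ []) →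
    a u ≡ α₁ → a v ≡ α₂ → a w ≡ α₃ → c u v ≡ γ₁₂ → c u w ≡ γ₁₃ → c v w ≡ γ₂₃ →
    TripleCounts (α₁ + α₂ + α₃) (γ₁₂ + γ₁₃ + γ₂₃) (t u v w)
  triple-counts {u} {v} {w} uvw! refl refl refl refl refl refl = record
    { symdiff    = ∣ ⟦ Δ ⟧ X ∣
    ; union      = ∣ ⟦ ∇ ⟧ X ∣
    ; t<9        = ∣⟦⟧∣<9 y (x₀ ∩ᵛ x₁ ∩ᵛ x₂)
    ; symdiff<9  = ∣⟦⟧∣<9 y Δ
    ; union<9    = ∣⟦⟧∣<9 y ∇
    ; symdiff-eq = venn (∣ Δ ∣ᶜ +ᶜ 2 *ᶜ Σc) (Σa +ᶜ 4 *ᶜ ∣ x₀ ∩ᵛ x₁ ∩ᵛ x₂ ∣ᶜ) X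
    ; union-eq   = venn (∣ ∇ ∣ᶜ +ᶜ Σc) (Σa +ᶜ ∣ x₀ ∩ᵛ x₁ ∩ᵛ x₂ ∣ᶜ) X
    ; allowed    = constraint y (unique⇒injective uvw!)
    }
    where
    y = lookup (u ∷ v ∷ w ∷ [])
    X = A ∘ y
    Δ ∇ : Venn 3
    Δ = x₀ ⊕ᵛ x₁ ⊕ᵛ x₂ ⊕ᵛ ∅
    ∇ = x₀ ∪ᵛ x₁ ∪ᵛ x₂
    Σa Σc : Count 3
    Σa = ∣ x₀ ∣ᶜ +ᶜ ∣ x₁ ∣ᶜ +ᶜ ∣ x₂ ∣ᶜ
    Σc = ∣ x₀ ∩ᵛ x₁ ∣ᶜ +ᶜ ∣ x₀ ∩ᵛ x₂ ∣ᶜ +ᶜ ∣ x₁ ∩ᵛ x₂ ∣ᶜ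

  quad-counts : ∀ {u v w z α₁ α₂ α₃ α₄ γ₁₂ γ₁₃ γ₁₄ γ₂₃ γ₂₄ γ₃₄ τ₁₂₃ τ₁₂₄ τ₁₃₄ τ₂₃₄} →
    Unique (u ∷ v ∷ w ∷ z ∷ []) →
    a u ≡ α₁ → a v ≡ α₂ → a w ≡ α₃ → a z ≡ α₄ →
    c u v ≡ γ₁₂ → c u w ≡ γ₁₃ → c u z ≡ γ₁₄ → c v w ≡ γ₂₃ → c v z ≡ γ₂₄ → c w z ≡ γ₃₄ →
    t u v w ≡ τ₁₂₃ → t u v z ≡ τ₁₂₄ → t u w z ≡ τ₁₃₄ → t v w z ≡ τ₂₃₄ →
    QuadCounts (α₁ + α₂ + α₃ + α₄) (γ₁₂ + γ₁₃ + γ₁₄ + γ₂₃ + γ₂₄ + γ₃₄) (τ₁₂₃ + τ₁₂₄ + τ₁₃₄ + τ₂₃₄)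
  quad-counts {u} {v} {w} {z} uvwz! refl refl refl refl refl refl refl refl refl refl refl refl refl refl =
    record
    { q          = ∣ ⟦ x₀ ∩ᵛ x₁ ∩ᵛ x₂ ∩ᵛ x₃ ⟧ X ∣
    ; symdiff    = ∣ ⟦ Δ ⟧ X ∣
    ; union      = ∣ ⟦ ∇ ⟧ X ∣
    ; q<9        = ∣⟦⟧∣<9 y (x₀ ∩ᵛ x₁ ∩ᵛ x₂ ∩ᵛ x₃)
    ; symdiff<9  = ∣⟦⟧∣<9 y Δ
    ; union<9    = ∣⟦⟧∣<9 y ∇
    ; symdiff-eq = venn (∣ Δ ∣ᶜ +ᶜ 2 *ᶜ Σc +ᶜ 8 *ᶜ ∣ x₀ ∩ᵛ x₁ ∩ᵛ x₂ ∩ᵛ x₃ ∣ᶜ) (Σa +ᶜ 4 *ᶜ Σt) X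
    ; union-eq   = venn (∣ ∇ ∣ᶜ +ᶜ Σc +ᶜ ∣ x₀ ∩ᵛ x₁ ∩ᵛ x₂ ∩ᵛ x₃ ∣ᶜ) (Σa +ᶜ Σt) X
    ; allowed    = constraint y (unique⇒injective uvwz!)
    }
    where
    y = lookup (u ∷ v ∷ w ∷ z ∷ [])
    X = A ∘ y
    Δ ∇ : Venn 4
    Δ = x₀ ⊕ᵛ x₁ ⊕ᵛ x₂ ⊕ᵛ x₃ ⊕ᵛ ∅
    ∇ = x₀ ∪ᵛ x₁ ∪ᵛ x₂ ∪ᵛ x₃
    Σa Σc Σt : Count 4
    Σa = ∣ x₀ ∣ᶜ +ᶜ ∣ x₁ ∣ᶜ +ᶜ ∣ x₂ ∣ᶜ +ᶜ ∣ x₃ ∣ᶜ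
    Σc = ∣ x₀ ∩ᵛ x₁ ∣ᶜ +ᶜ ∣ x₀ ∩ᵛ x₂ ∣ᶜ +ᶜ ∣ x₀ ∩ᵛ x₃ ∣ᶜ +ᶜ ∣ x₁ ∩ᵛ x₂ ∣ᶜ +ᶜ ∣ x₁ ∩ᵛ x₃ ∣ᶜ +ᶜ ∣ x₂ ∩ᵛ x₃ ∣ᶜ
    Σt = ∣ x₀ ∩ᵛ x₁ ∩ᵛ x₂ ∣ᶜ +ᶜ ∣ x₀ ∩ᵛ x₁ ∩ᵛ x₃ ∣ᶜ +ᶜ ∣ x₀ ∩ᵛ x₂ ∩ᵛ x₃ ∣ᶜ +ᶜ ∣ x₁ ∩ᵛ x₂ ∩ᵛ x₃ ∣ᶜ

  fives-meet : ∀ {u v} → u ≢ v → a u ≡ 5 → a v ≡ 5 → c u v ≡ 2 ⊎ c u v ≡ 3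
  fives-meet u≢v au≡5 av≡5 = fives-meet-in-2-or-3 (pair-counts u≢v au≡5 av≡5)

  fives-meet-in-3 : ∀ {u v} → u ≢ v → a u ≡ 5 → a v ≡ 5 → c u v ≢ 2 → c u v ≡ 3
  fives-meet-in-3 u≢v au≡5 av≡5 c≢2 = Sum.[ ⊥-elim ∘ c≢2 , id ]′ (fives-meet u≢v au≡5 av≡5)

  seven-meets-4 : ∀ {u v} → u ≢ v → a u ≡ 7 → a v ≡ 5 × c u v ≡ 4
  seven-meets-4 {v = v} u≢v au≡7 with size-5-or-7 v
  ... | inj₁ av≡5 = av≡5 , five-seven-meet-in-4 (pair-counts u≢v au≡7 av≡5)
  ... | inj₂ av≡7 = ⊥-elim (no-two-sevens (pair-counts u≢v au≡7 av≡7))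

  no-four-meeting-in-3 : ∀ {u v w z} → Unique (u ∷ v ∷ w ∷ z ∷ []) → All (λ x → a x ≡ 5) (u ∷ v ∷ w ∷ z ∷ []) →
    ¬ AllPairs (λ x y → c x y ≡ 3) (u ∷ v ∷ w ∷ z ∷ [])
  no-four-meeting-in-3
    uvwz!@((u≢v ∷ u≢w ∷ u≢z ∷ []) ∷ (v≢w ∷ v≢z ∷ []) ∷ (w≢z ∷ []) ∷ [] ∷ [])
    (au ∷ av ∷ aw ∷ az ∷ [])
    ((cuv ∷ cuw ∷ cuz ∷ []) ∷ (cvw ∷ cvz ∷ []) ∷ (cwz ∷ []) ∷ [] ∷ []) =
    no-four-threes (quad-counts uvwz! au av aw az cuv cuw cuz cvw cvz cwz
      (threes-meet-in-2 (triple-counts ((u≢v ∷ u≢w ∷ []) ∷ (v≢w ∷ []) ∷ [] ∷ []) au av aw cuv cuw cvw))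
      (threes-meet-in-2 (triple-counts ((u≢v ∷ u≢z ∷ []) ∷ (v≢z ∷ []) ∷ [] ∷ []) au av az cuv cuz cvz))
      (threes-meet-in-2 (triple-counts ((u≢w ∷ u≢z ∷ []) ∷ (w≢z ∷ []) ∷ [] ∷ []) au aw az cuw cuz cwz))
      (threes-meet-in-2 (triple-counts ((v≢w ∷ v≢z ∷ []) ∷ (w≢z ∷ []) ∷ [] ∷ []) av aw az cvw cvz cwz)))

  -- If ∣ A u ∣ = 7, the other four sets have size 5 and meet A u in 4 points, hence each other in 3.
  no-seven : ∀ u → a u ≢ 7
  no-seven u au≡7 = no-four-meeting-in-3 (AllPairsₚ.tabulate⁺ o-distinct)
                      (Allₚ.tabulate⁺ (proj₁ ∘ meets-u)) (AllPairsₚ.tabulate⁺ others-meet-in-3)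
    where
    o : Fin 4 → Fin 5
    o = punchIn u
    o-distinct : ∀ {i j} → i ≢ j → o i ≢ o j
    o-distinct i≢j = i≢j ∘ punchIn-injective u _ _
    u≢o : ∀ i → u ≢ o i
    u≢o i = punchInᵢ≢i u i ∘ sym
    meets-u : ∀ i → a (o i) ≡ 5 × c u (o i) ≡ 4
    meets-u i = seven-meets-4 (u≢o i) au≡7
    others-meet-in-3 : ∀ {i j} → i ≢ j → c (o i) (o j) ≡ 3
    others-meet-in-3 {i} {j} i≢j = fives-meet-in-3 (o-distinct i≢j) (proj₁ (meets-u i)) (proj₁ (meets-u j)) λ c≡2 →
      no-seven-meeting-4-4-2 (triple-counts ((u≢o i ∷ u≢o j ∷ []) ∷ (o-distinct i≢j ∷ []) ∷ [] ∷ []) au≡7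
        (proj₁ (meets-u i)) (proj₁ (meets-u j)) (proj₂ (meets-u i)) (proj₂ (meets-u j)) c≡2)

  all-five : ∀ u → a u ≡ 5
  all-five u = Sum.[ id , ⊥-elim ∘ no-seven u ]′ (size-5-or-7 u)

  _~_ : Fin 5 → Fin 5 → Set
  u ~ v = c u v ≡ 2

  ~-sym : ∀ {u v} → u ~ v → v ~ u
  ~-sym {u} {v} = subst (_≡ 2) (cong ∣_∣ (∩-comm (A u) (A v)))

  ~-irrefl : ∀ {u} → ¬ u ~ u
  ~-irrefl {u} u~u = 5≢2 (trans (sym (all-five u)) (trans (cong ∣_∣ (sym (∩-idem (A u)))) u~u))
    where
    5≢2 : 5 ≢ 2
    5≢2 ()

  no-path : ∀ {u v w} → u ≢ w → u ~ v → ¬ v ~ w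
  no-path {u} {v} {w} u≢w u~v v~w =
    no-path-of-2s (fives-meet u≢w (all-five u) (all-five w))
      (triple-counts ((u≢v ∷ u≢w ∷ []) ∷ (v≢w ∷ []) ∷ [] ∷ []) (all-five u) (all-five v) (all-five w) u~v refl v~w)
    where
    u≢v : u ≢ v
    u≢v refl = ~-irrefl u~v
    v≢w : v ≢ w
    v≢w refl = ~-irrefl v~w

  no-independent-4 : ∀ {u v w z} → Unique (u ∷ v ∷ w ∷ z ∷ []) →
    ¬ AllPairs (λ x y → ¬ x ~ y) (u ∷ v ∷ w ∷ z ∷ [])
  no-independent-4 {u} {v} {w} {z} uvwz! independent =
    no-four-meeting-in-3 uvwz! (all-five u ∷ all-five v ∷ all-five w ∷ all-five z ∷ [])
      (AllPairs.zipWith (λ (x≢y , x≁y) → fives-meet-in-3 x≢y (all-five _) (all-five _) x≁y) (uvwz! , independent))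

  open TwoDisjointEdges (λ u v → c u v ≟ 2) ~-sym ~-irrefl no-path no-independent-4
    using (TwoEdges; two-disjoint-edges) public

pair-pattern : ∀ {n} {C : Fin 13 → V n} → Injective _≡_ _≡_ C → IsCap C →
  ∀ {B Bx} → IsBxFamily C B Bx → ∣ B ∣ ≡ 8 →
  (Σ (Fin 5 → Fin 13) λ x → Injective _≡_ _≡_ x × image x ⊤ ≡ ∁ B) → PairPattern B Bx
pair-pattern C-inj cap {B} {Bx} fam ∣B∣≡8 (x , x-inj , image≡∁B) = from-two-edges two-disjoint-edges
  where
  x∉B : ∀ u → x u ∉ B
  x∉B u = x∈∁p⇒x∉p (subst (x u ∈_) image≡∁B (∈-image⁺ x-inj ∈⊤))
  x-onto : ∀ {s} → s ∉ B → ∃ λ u → x u ≡ s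
  x-onto s∉B = Product.map₂ proj₂ (∈-image⁻ x ⊤ (subst (_ ∈_) (sym image≡∁B) (x∉p⇒x∈∁p s∉B)))
  open FiveOddSets ∣B∣≡8 (Bx ∘ x) (λ u → proj₁ (fam (x u) (x∉B u))) (λ u → proj₁ (proj₂ (fam (x u) (x∉B u))))
    (λ y y-inj → outside-points-constraint C-inj cap fam (x ∘ y) (y-inj ∘ x-inj) (x∉B ∘ y))
  ∣∁B∣≡5 : ∣ ∁ B ∣ ≡ 5
  ∣∁B∣≡5 = trans (cong ∣_∣ (sym image≡∁B)) (trans (∣image∣ x-inj ⊤) (∣⊤∣≡n 5))
  sizes : ∀ s → s ∉ B → ∣ Bx s ∣ ≡ 5
  sizes s s∉B = let (u , xu≡s) = x-onto s∉B in subst (λ s → ∣ Bx s ∣ ≡ 5) xu≡s (all-five u)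
  from-two-edges : TwoEdges → PairPattern B Bx
  from-two-edges
    (i , j , k , l , ((i≢j ∷ i≢k ∷ i≢l ∷ []) ∷ (j≢k ∷ j≢l ∷ []) ∷ (k≢l ∷ []) ∷ [] ∷ []) , i~j , k~l , only-matched) =
    ∣∁B∣≡5 , sizes , x i , x j , x k , x l , x∉B i , x∉B j , x∉B k , x∉B l ,
    x-≢ i≢j , x-≢ i≢k , x-≢ i≢l , x-≢ j≢k , x-≢ j≢l , x-≢ k≢l , i~j , k~l , others-meet-in-3
    where
    x-≢ : ∀ {u v} → u ≢ v → x u ≢ x v
    x-≢ u≢v = u≢v ∘ x-inj
    others-meet-in-3 : ∀ s t → s ∉ B → t ∉ B → s ≢ t → ¬ Matched (x i) (x j) (x k) (x l) s t →
      ∣ Bx s ∩ Bx t ∣ ≡ 3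
    others-meet-in-3 s t s∉B t∉B =
      let (u , xu≡s) = x-onto s∉B ; (v , xv≡t) = x-onto t∉B in
      subst₂ (λ s t → s ≢ t → ¬ Matched (x i) (x j) (x k) (x l) s t → ∣ Bx s ∩ Bx t ∣ ≡ 3) xu≡s xv≡t
        λ xu≢xv unmatched →
          fives-meet-in-3 (xu≢xv ∘ cong x) (all-five u) (all-five v) (unmatched ∘ Matched-map x ∘ only-matched)

theorem8p1 : (n : ℕ) (C : Fin 13 → V n) → Injective _≡_ _≡_ C →
    IsCap C → HasDim C 7 → (B : Subset 13) → IsBasis C ⊤ B →
    Σ (Fin 13 → Subset 13) (IsBxFamily C B) ×
    ((Bx : Fin 13 → Subset 13) → IsBxFamily C B Bx → PairPattern B Bx)
theorem8p1 n C C-inj cap dim B basis = basis-coordinates basis , λ Bx fam →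
  pair-pattern C-inj cap fam ∣B∣≡8 (enumerate 5 (∁ B) ∣∁B∣≡5)
  where
  ∣B∣≡8 : ∣ B ∣ ≡ 8
  ∣B∣≡8 = basis-size dim basis
  ∣∁B∣≡5 : ∣ ∁ B ∣ ≡ 5
  ∣∁B∣≡5 = trans (∣∁p∣≡n∸∣p∣ B) (cong (13 ∸_) ∣B∣≡8)
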